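{- Let $M$ be a monotonic machine over a finite alphabet $\Sigma$. Let $s = s_1 \cdots s_L$ be a sequence of length $L \ge 1$ that covers a state $V$ of the transformed machine $S(M)$. Then $s[1, L-1]$ covers the state $\mathrm{par}(V; s_L)$ of $S(M)$.
   Context: A machine $M$ is a finite DAG whose edges $e$ carry labels $\mathrm{lab}(e) \in \Sigma$, with a designated initial state $i$ having no incoming edges. If $(w,v)$ is an edge, then $w$ is a parent state of $v$; ancestors are obtained by iterating this relation. A sequence $s$ covers a state $v$ if there are indices $i_1 < \dots < i_N$ and a directed path from the initial state to $v$ of $N$ edges labeled, in order, $s_{i_1}, \dots, s_{i_N}$. The initial state is covered by every sequence, including the empty one. A machine is monotonic if every sequence covering a state also covers each of its parent states. For a sequence $s$, $s[1,L-1] = s_1 \cdots s_{L-1}$. Construction of $S(M)$. For a set $V$ of states of $M$ and $a \in \Sigma$: - $\mathrm{sub}(V;a) = \{w : (w,v) \text{ is an edge labeled } a,\ v \in V\}$; - $\mathrm{par}(V;a) = \min(\mathrm{sub}(V;a) \cup V)$, where $\min(X)$ keeps the states of $X$ with no proper ancestor in $X$; - $\mathrm{inc}(V)$ is the set of labels of edges entering states of $V$; - $\mathrm{cl}(V) = \{V\} \cup \bigcup_{a \in \mathrm{inc}(V)} \mathrm{cl}(\mathrm{par}(V;a))$, with $\mathrm{cl}(V) = \{V\}$ if $\mathrm{inc}(V) = \emptyset$. The states of $S(M)$ are the members of $\bigcup_{v \in V(M)} \mathrm{cl}(\{v\})$. For each such $V$ and each $a \in \mathrm{inc}(V)$, $S(M)$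 has an edge labeled $a$ from $\mathrm{par}(V;a)$ to $V$. The initial state is $\{i\}$. -}

module Defs where

open import Level using (0ℓ)
open import Data.Nat using (ℕ)
open import Data.Fin using (Fin)
open import Data.Fin.Subset using (Subset; _∈_; ⁅_⁆)
open import Data.List using (List; []; _∷ʳ_)
open import Data.List.Relation.Binary.Sublist.Propositional using (_⊆_)
import Data.List.Membership.Propositional as LMem
open import Data.Product using (Σ; ∃; ∃-syntax; _×_; _,_)
open import Data.Sum using (_⊎_)
open import Relation.Nullary using (¬_)
open import Function.Bundles using (_⇔_)

data Path {Q L : Set} (E : Q → L → Q → Set) (init : Q) : Q → List L → Set where
  [] : Path E init init []
  _▷_ : ∀ {w v a ls} → Path E init w ls → E w a v → Path E init v (ls ∷ʳ a)

Covers : {Q L : Set} (E : Q → L → Q → Set) (init : Q) → List L → Q → Set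
Covers E init s v = ∃[ ls ] (Path E init v ls × ls ⊆ s)

record Machine (n k : ℕ) : Set where
  field
    edges : List (Fin n × Fin k × Fin n)
    init  : Fin n

  Edge : Fin n → Fin k → Fin n → Set
  Edge w a v = LMem._∈_ (w , a , v) edges

  Parent : Fin n → Fin n → Set
  Parent w v = ∃[ a ] Edge w a v

  field
    init-noIn : ∀ w a → ¬ Edge w a init

data Ancestor {n k} (M : Machine n k) : Fin n → Fin n → Set where
  par₁ : ∀ {w v} → Machine.Parent M w v → Ancestor M w v
  par₊ : ∀ {w u v} → Ancestor M w u → Machine.Parent M u v → Ancestor M w v

Acyclic : ∀ {n k} → Machine n k → Set
Acyclic M = ∀ v → ¬ Ancestor M v v

CoversM : ∀ {n k} → Machine n k → List (Fin k) → Fin n → Set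
CoversM M = Covers (Machine.Edge M) (Machine.init M)

Monotonic : ∀ {n k} → Machine n k → Set
Monotonic M = ∀ s v w → Machine.Parent M w v → CoversM M s v → CoversM M s w

module _ {n k} (M : Machine n k) where
  open Machine M

  InSub : Subset n → Fin k → Fin n → Set
  InSub V a w = ∃[ v ] (v ∈ V × Edge w a v)

  InMin : (Fin n → Set) → Fin n → Set
  InMin X w = X w × (∀ u → X u → ¬ Ancestor M u w)

  InPar : Subset n → Fin k → Fin n → Set
  InPar V a = InMin (λ w → InSub V a w ⊎ w ∈ V)

  IsPar : Subset n → Fin k → Subset n → Set
  IsPar V a W = ∀ w → (w ∈ W) ⇔ InPar V a w

  Inc : Subset n → Fin k → Set
  Inc V a = ∃[ w ] ∃[ v ] (v ∈ V × Edge w a v)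

  -- Cl V U  :⇔  U ∈ cl(V)   (least family satisfying the recursive equation)
  data Cl (V : Subset n) : Subset n → Set where
    here  : Cl V V
    there : ∀ {a W U} → Inc V a → IsPar V a W → Cl W U → Cl V U

  SState : Subset n → Set
  SState U = ∃[ v ] Cl ⁅ v ⁆ U

  SEdge : Subset n → Fin k → Subset n → Set
  SEdge W a V = SState V × Inc V a × IsPar V a W

  SInit : Subset n
  SInit = ⁅ init ⁆

  CoversS : List (Fin k) → Subset n → Set
  CoversS = Covers SEdge SInit

-- A covering of V in S(M) projects to a covering of some v ∈ V in M, and a
-- covering of v by s ∷ʳ a yields a covering by s of some element of
-- sub(V;a) ∪ V, hence (monotonicity, well-foundedness) of a minimal one,
-- i.e. of some m ∈ par(V;a). Conversely, a covering in M of an element of an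
-- S(M)-state U lifts to a covering of U in S(M), by induction along the
-- sequence: the last letter is either skipped, or it labels an edge w → v,
-- and then the prefix covers an element of par(U;b), the S(M)-parent of U.
-- The recursion ends at {init}: it is the only state containing init, since
-- states of S(M) are antichains whose elements, by monotonicity, are all
-- reachable from init.
module Submission where

open import Defs
open import Data.Bool using (true)
open import Data.Empty using (⊥-elim)
open import Data.Fin using (Fin; _≟_)
open import Data.Fin.Induction using (spo-wellFounded)
open import Data.Fin.Properties using (any?; all?)
open import Data.Fin.Subset using (Subset; _∈_; ⁅_⁆)
open import Data.Fin.Subset.Properties using (_∈?_; ⊆-antisym; x∈⁅x⁆; x∈⁅y⁆⇒x≡y)
open import Data.List using (List; []; _∷_; _∷ʳ_)
open import Data.List.Membership.DecPropositional using () renaming (_∈?_ to ∈-dec)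
open import Data.List.Properties using (∷ʳ-injective; ++-conicalʳ)
open import Data.List.Relation.Binary.Sublist.Propositional as Sublist using (_⊆_; ⊆-refl; ⊆-trans)
open import Data.List.Relation.Binary.Sublist.Propositional.Properties using (++⁺; ++⁺ʳ)
open import Data.List.Reverse using (Reverse; []; _∶_∶ʳ_; reverseView)
open import Data.Product using (∃-syntax; _×_; _,_; proj₁; proj₂)
open import Data.Product.Properties using (≡-dec)
open import Data.Sum using (_⊎_; inj₁; inj₂)
open import Data.Vec using (tabulate)
open import Data.Vec.Properties using (lookup⇒[]=; []=⇒lookup; lookup∘tabulate)
open import Function using (_∘_)
open import Function.Bundles using (_⇔_; mk⇔; Equivalence)
open import Induction.WellFounded using (WellFounded; Acc; acc)
open import Relation.Binary.Construct.Closure.Reflexive using (ReflClosure; refl; [_])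
open import Relation.Binary.Construct.Closure.Reflexive.Properties using (fromSum; toSum)
open import Relation.Binary.PropositionalEquality
  using (_≡_; sym; trans; subst; isEquivalence; resp₂)
  renaming (refl to ≡-refl)
open import Relation.Nullary using (¬_; Dec; yes; no; does)
open import Relation.Nullary.Decidable
  using (map′; _×-dec_; _⊎-dec_; ¬?; _→-dec_; dec-true)

open Equivalence using (to; from)

⊆-∷ʳ⁻ : ∀ {A : Set} {ls : List A} s a → ls ⊆ s ∷ʳ a →
        ls ⊆ s ⊎ ∃[ ms ] (ls ≡ ms ∷ʳ a × ms ⊆ s)
⊆-∷ʳ⁻ []      a (_ Sublist.∷ʳ Sublist.[])   = inj₁ Sublist.[]
⊆-∷ʳ⁻ []      a (≡-refl Sublist.∷ Sublist.[]) = inj₂ ([] , ≡-refl , Sublist.[])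
⊆-∷ʳ⁻ (x ∷ s) a (_ Sublist.∷ʳ p) with ⊆-∷ʳ⁻ s a p
... | inj₁ q                 = inj₁ (x Sublist.∷ʳ q)
... | inj₂ (ms , ≡-refl , q) = inj₂ (ms , ≡-refl , x Sublist.∷ʳ q)
⊆-∷ʳ⁻ (x ∷ s) a (≡-refl Sublist.∷ p) with ⊆-∷ʳ⁻ s a p
... | inj₁ q                 = inj₁ (≡-refl Sublist.∷ q)
... | inj₂ (ms , ≡-refl , q) = inj₂ (x ∷ ms , ≡-refl , ≡-refl Sublist.∷ q)

∈-tabulate-does : ∀ {n} {P : Fin n → Set} (P? : ∀ x → Dec (P x)) x →
                  x ∈ tabulate (does ∘ P?) ⇔ P x
∈-tabulate-does P? x = mk⇔
  (λ x∈ → witness (P? x) (trans (sym (lookup∘tabulate _ x)) ([]=⇒lookup x∈)))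
  (λ Px → lookup⇒[]= x _ (trans (lookup∘tabulate _ x) (dec-true (P? x) Px)))
  where
    witness : ∀ {A : Set} (A? : Dec A) → does A? ≡ true → A
    witness (yes a) _ = a

module _ {Q L : Set} {E : Q → L → Q → Set} {i : Q} where

  Path-[]⁻ : ∀ {v ls} → Path E i v ls → ls ≡ [] → v ≡ i
  Path-[]⁻ []                   _  = ≡-refl
  Path-[]⁻ (_▷_ {ls = ls} _ _) eq with () ← ++-conicalʳ ls _ eq

  Path-∷ʳ⁻ : ∀ {v ls ms a} → Path E i v ls → ls ≡ ms ∷ʳ a →
             ∃[ w ] (E w a v × Path E i w ms)
  Path-∷ʳ⁻ {ms = ms} [] eq with () ← ++-conicalʳ ms _ (sym eq)
  Path-∷ʳ⁻ {ms = ms} (_▷_ {ls = ls} p e) eq with ∷ʳ-injective ls ms eq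
  ... | ≡-refl , ≡-refl = _ , e , p

  Covers-⊆ : ∀ {s t v} → s ⊆ t → Covers E i s v → Covers E i t v
  Covers-⊆ s⊆t (ls , p , ls⊆s) = ls , p , ⊆-trans ls⊆s s⊆t

  Covers-weaken : ∀ {s a v} → Covers E i s v → Covers E i (s ∷ʳ a) v
  Covers-weaken {a = a} = Covers-⊆ (++⁺ʳ (a ∷ []) ⊆-refl)

  Covers-step : ∀ {s w a v} → Covers E i s w → E w a v → Covers E i (s ∷ʳ a) v
  Covers-step {a = a} (ls , p , ls⊆s) e = ls ∷ʳ a , p ▷ e , ++⁺ ls⊆s ⊆-refl

  Covers-[]⁻ : ∀ {v} → Covers E i [] v → v ≡ i
  Covers-[]⁻ (_ , p , Sublist.[]) = Path-[]⁻ p ≡-refl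

  Covers-∷ʳ⁻ : ∀ {s a v} → Covers E i (s ∷ʳ a) v →
               Covers E i s v ⊎ ∃[ w ] (E w a v × Covers E i s w)
  Covers-∷ʳ⁻ {s} {a} (ls , p , ls⊆sa) with ⊆-∷ʳ⁻ s a ls⊆sa
  ... | inj₁ ls⊆s = inj₁ (ls , p , ls⊆s)
  ... | inj₂ (ms , ≡-refl , ms⊆s) with Path-∷ʳ⁻ p ≡-refl
  ...   | w , e , p′ = inj₂ (w , e , ms , p′ , ms⊆s)

module _ {n k} (M : Machine n k) where
  open Machine M

  _≼_ : Fin n → Fin n → Set
  _≼_ = ReflClosure (Ancestor M)

  Ancestor-trans : ∀ {u w v} → Ancestor M u w → Ancestor M w v → Ancestor M u v
  Ancestor-trans u<w (par₁ p)     = par₊ u<w p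
  Ancestor-trans u<w (par₊ w<x p) = par₊ (Ancestor-trans u<w w<x) p

  ≼-Ancestor : ∀ {u w v} → u ≼ w → Ancestor M w v → Ancestor M u v
  ≼-Ancestor refl    w<v = w<v
  ≼-Ancestor [ u<w ] w<v = Ancestor-trans u<w w<v

  Ancestor-last : ∀ {u v} → Ancestor M u v → ∃[ w ] (u ≼ w × Parent w v)
  Ancestor-last (par₁ p)     = _ , refl , p
  Ancestor-last (par₊ u<w p) = _ , [ u<w ] , p

  Antichain : Subset n → Set
  Antichain V = ∀ {u v} → u ∈ V → v ∈ V → ¬ Ancestor M u v

  IsPar⇒Antichain : ∀ {V a W} → IsPar M V a W → Antichain W
  IsPar⇒Antichain isPar {u} {v} u∈W v∈W =
    proj₂ (to (isPar v) v∈W) u (proj₁ (to (isPar u) u∈W))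

  Cl-antichain : ∀ {Y V} → Antichain Y → Cl M Y V → Antichain V
  Cl-antichain anti here              = anti
  Cl-antichain _    (there _ isPar c) = Cl-antichain (IsPar⇒Antichain isPar) c

  Cl-∷ʳ : ∀ {Y V a W} → Cl M Y V → Inc M V a → IsPar M V a W → Cl M Y W
  Cl-∷ʳ here                  inc isPar = there inc isPar here
  Cl-∷ʳ (there inc′ isPar′ c) inc isPar = there inc′ isPar′ (Cl-∷ʳ c inc isPar)

  Cl-≼ : ∀ {Y V x} → Cl M Y V → x ∈ V → ∃[ y ] (y ∈ Y × x ≼ y)
  Cl-≼ here x∈V = _ , x∈V , refl
  Cl-≼ (there {a = a} _ isPar c) x∈ with Cl-≼ c x∈
  ... | y , y∈W , x≼y with proj₁ (to (isPar y) y∈W)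
  ...   | inj₂ y∈V           = y , y∈V , x≼y
  ...   | inj₁ (v , v∈V , e) = v , v∈V , [ ≼-Ancestor x≼y (par₁ (a , e)) ]

  Path⇒reachable : ∀ {v ls} → Path Edge init v ls → init ≼ v
  Path⇒reachable []      = refl
  Path⇒reachable (p ▷ e) = [ ≼-Ancestor (Path⇒reachable p) (par₁ (_ , e)) ]

  Covers-extend : ∀ {s u v} → Ancestor M u v → CoversM M s u → ∃[ t ] CoversM M t v
  Covers-extend (par₁ (_ , e))     c = _ , Covers-step c e
  Covers-extend (par₊ u<w (_ , e)) c = _ , Covers-step (proj₂ (Covers-extend u<w c)) e

  reachable⇒covered : ∀ {v} → init ≼ v → ∃[ s ] CoversM M s v
  reachable⇒covered refl       = [] , [] , [] , Sublist.[]
  reachable⇒covered [ init<v ] = Covers-extend init<v ([] , [] , Sublist.[])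

  PathS⇒CoversM : ∀ {V ls} → Path (SEdge M) (SInit M) V ls → ∃[ v ] (v ∈ V × CoversM M ls v)
  PathS⇒CoversM [] = init , x∈⁅x⁆ init , [] , [] , Sublist.[]
  PathS⇒CoversM (P ▷ (_ , _ , isPar)) with PathS⇒CoversM P
  ... | u , u∈U , c with proj₁ (to (isPar u) u∈U)
  ...   | inj₂ u∈V           = u , u∈V , Covers-weaken c
  ...   | inj₁ (v , v∈V , e) = v , v∈V , Covers-step c e

  CoversS⇒CoversM : ∀ {s V} → CoversS M s V → ∃[ v ] (v ∈ V × CoversM M s v)
  CoversS⇒CoversM (_ , P , ls⊆s) with PathS⇒CoversM P
  ... | v , v∈V , c = v , v∈V , Covers-⊆ ls⊆s c

  edge? : ∀ w a v → Dec (Edge w a v)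
  edge? w a v = ∈-dec (≡-dec _≟_ (≡-dec _≟_ _≟_)) (w , a , v) edges

  parent? : ∀ w v → Dec (Parent w v)
  parent? w v = any? (λ a → edge? w a v)

  inSub? : ∀ V a w → Dec (InSub M V a w)
  inSub? V a w = any? (λ v → (v ∈? V) ×-dec edge? w a v)

  inc? : ∀ V a → Dec (Inc M V a)
  inc? V a = any? (inSub? V a)

  InSub∪ : Subset n → Fin k → Fin n → Set
  InSub∪ V a w = InSub M V a w ⊎ w ∈ V

  inSub∪? : ∀ V a w → Dec (InSub∪ V a w)
  inSub∪? V a w = inSub? V a w ⊎-dec (w ∈? V)

  ¬Inc⇒par≡ : ∀ {V a W} → Antichain V → ¬ Inc M V a → IsPar M V a W → W ≡ V
  ¬Inc⇒par≡ {V} {a} anti ¬inc isPar = ⊆-antisym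
    (λ {x} x∈W → inV (proj₁ (to (isPar x) x∈W)))
    (λ {x} x∈V → from (isPar x) (inj₂ x∈V , λ u u∈ → notBelow x∈V u∈))
    where
      inV : ∀ {x} → InSub∪ V a x → x ∈ V
      inV {x} (inj₁ sub) = ⊥-elim (¬inc (x , sub))
      inV (inj₂ x∈V)     = x∈V
      notBelow : ∀ {x u} → x ∈ V → InSub∪ V a u → ¬ Ancestor M u x
      notBelow {u = u} _ (inj₁ sub) = λ _ → ¬inc (u , sub)
      notBelow x∈V (inj₂ u∈V)       = anti u∈V x∈V

  module _ (mono : Monotonic M) where

    Covers-ancestor : ∀ {s u v} → Ancestor M u v → CoversM M s v → CoversM M s u
    Covers-ancestor (par₁ p)     c = mono _ _ _ p c
    Covers-ancestor (par₊ u<w p) c = Covers-ancestor u<w (mono _ _ _ p c)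

    Covers-≼ : ∀ {s u v} → u ≼ v → CoversM M s v → CoversM M s u
    Covers-≼ refl    c = c
    Covers-≼ [ u<v ] c = Covers-ancestor u<v c

  module _ (acyclic : Acyclic M) where

    ⁅⁆-antichain : ∀ y → Antichain ⁅ y ⁆
    ⁅⁆-antichain y u∈ v∈ with x∈⁅y⁆⇒x≡y y u∈ | x∈⁅y⁆⇒x≡y y v∈
    ... | ≡-refl | ≡-refl = acyclic y

    SState⇒Antichain : ∀ {V} → SState M V → Antichain V
    SState⇒Antichain (y , c) = Cl-antichain (⁅⁆-antichain y) c

    par-SState : ∀ {V a W} → SState M V → IsPar M V a W → SState M W
    par-SState {V} {a} (y , c) isPar with inc? V a
    ... | yes inc = y , Cl-∷ʳ c inc isPar
    ... | no ¬inc = subst (SState M) (sym (¬Inc⇒par≡ (SState⇒Antichain (y , c)) ¬inc isPar)) (y , c)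

    Ancestor-wellFounded : WellFounded (Ancestor M)
    Ancestor-wellFounded = spo-wellFounded record
      { isEquivalence = isEquivalence
      ; irrefl        = λ { ≡-refl → acyclic _ }
      ; trans         = Ancestor-trans
      ; <-resp-≈      = resp₂ (Ancestor M)
      }

    ancestor? : ∀ u v → Dec (Ancestor M u v)
    ancestor? u v = go v (Ancestor-wellFounded v)
      where
        go : ∀ v → Acc (Ancestor M) v → Dec (Ancestor M u v)
        go v (acc below) = map′ (λ (w , u≼w , p) → ≼-Ancestor u≼w (par₁ p)) Ancestor-last (any? step)
          where
            step : ∀ w → Dec (u ≼ w × Parent w v)
            step w with parent? w v
            ... | no ¬p = no (¬p ∘ proj₂)
            ... | yes p = map′ (_, p) proj₁ (map′ fromSum toSum ((u ≟ w) ⊎-dec go w (below (par₁ p))))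

    minimal-≼ : (X : Fin n → Set) → (∀ x → Dec (X x)) → ∀ {x} → X x → ∃[ m ] (InMin M X m × m ≼ x)
    minimal-≼ X X? {x} Xx = go x (Ancestor-wellFounded x) Xx
      where
        go : ∀ x → Acc (Ancestor M) x → X x → ∃[ m ] (InMin M X m × m ≼ x)
        go x (acc below) Xx with any? (λ u → X? u ×-dec ancestor? u x)
        ... | no none = x , (Xx , λ u Xu u<x → none (u , Xu , u<x)) , refl
        ... | yes (u , Xu , u<x) with go u (below u<x) Xu
        ...   | m , min , m≼u = m , min , [ ≼-Ancestor m≼u u<x ]

    inPar? : ∀ V a w → Dec (InPar M V a w)
    inPar? V a w = inSub∪? V a w ×-dec all? (λ u → inSub∪? V a u →-dec ¬? (ancestor? u w))

    par : Subset n → Fin k → Subset n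
    par V a = tabulate (does ∘ inPar? V a)

    par-isPar : ∀ V a → IsPar M V a (par V a)
    par-isPar V a = ∈-tabulate-does (inPar? V a)

    module _ (mono : Monotonic M) where

      par-covered : ∀ {V a W s x} → IsPar M V a W → InSub∪ V a x → CoversM M s x →
                    ∃[ m ] (m ∈ W × CoversM M s m)
      par-covered {V} {a} isPar Xx c with minimal-≼ (InSub∪ V a) (inSub∪? V a) Xx
      ... | m , min , m≼x = m , from (isPar m) min , Covers-≼ mono m≼x c

      par-covered-by-prefix : ∀ {V a W s v} → IsPar M V a W → v ∈ V → CoversM M (s ∷ʳ a) v →
                              ∃[ m ] (m ∈ W × CoversM M s m)
      par-covered-by-prefix isPar v∈V c with Covers-∷ʳ⁻ c
      ... | inj₁ c′           = par-covered isPar (inj₂ v∈V) c′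
      ... | inj₂ (w , e , c′) = par-covered isPar (inj₁ (_ , v∈V , e)) c′

      init∈SState⇒≡⁅init⁆ : ∀ {V} → SState M V → init ∈ V → V ≡ ⁅ init ⁆
      init∈SState⇒≡⁅init⁆ {V} (y , c) init∈V = ⊆-antisym V⊆ ⊆V
        where
          reachable : ∀ {x} → x ∈ V → init ≼ x
          reachable x∈V with Cl-≼ c x∈V | Cl-≼ c init∈V
          ... | z , z∈ , x≼z | z′ , z′∈ , init≼z′ with x∈⁅y⁆⇒x≡y y z∈ | x∈⁅y⁆⇒x≡y y z′∈
          ... | ≡-refl | ≡-refl with reachable⇒covered init≼z′
          ...   | _ , cy with Covers-≼ mono x≼z cy
          ...     | _ , p , _ = Path⇒reachable p
          V⊆ : ∀ {x} → x ∈ V → x ∈ ⁅ init ⁆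
          V⊆ x∈V with reachable x∈V
          ... | refl       = x∈⁅x⁆ init
          ... | [ init<x ] = ⊥-elim (SState⇒Antichain (y , c) init∈V x∈V init<x)
          ⊆V : ∀ {x} → x ∈ ⁅ init ⁆ → x ∈ V
          ⊆V x∈ with x∈⁅y⁆⇒x≡y init x∈
          ... | ≡-refl = init∈V

      CoversM⇒CoversS : ∀ s {V v} → SState M V → v ∈ V → CoversM M s v → CoversS M s V
      CoversM⇒CoversS s = go (reverseView s)
        where
          go : ∀ {s} → Reverse s → ∀ {V v} → SState M V → v ∈ V → CoversM M s v → CoversS M s V
          go [] st v∈V c with Covers-[]⁻ c
          ... | ≡-refl = subst (CoversS M []) (sym (init∈SState⇒≡⁅init⁆ st v∈V)) ([] , [] , Sublist.[])
          go (_ ∶ r ∶ʳ b) {V} st v∈V c with Covers-∷ʳ⁻ c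
          ... | inj₁ c′ = Covers-weaken (go r st v∈V c′)
          ... | inj₂ (w , e , c′) with par-covered (par-isPar V b) (inj₁ (_ , v∈V , e)) c′
          ...   | m , m∈U , cm = Covers-step (go r (par-SState st (par-isPar V b)) m∈U cm)
                                             (st , (w , _ , v∈V , e) , par-isPar V b)

mainTheorem7 : ∀ {n k} (M : Machine n k) → Acyclic M → Monotonic M →
    ∀ (V : Subset n) → SState M V →
    ∀ (s : List (Fin k)) (a : Fin k) → CoversS M (s ∷ʳ a) V →
    ∀ (W : Subset n) → IsPar M V a W → CoversS M s W
mainTheorem7 M acyclic mono V st s a c W isPar with CoversS⇒CoversM M c
... | v , v∈V , cv with par-covered-by-prefix M acyclic mono isPar v∈V cv
...   | m , m∈W , cm = CoversM⇒CoversS M acyclic mono s (par-SState M acyclic st isPar) m∈W cm
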